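{- There are functions $f,g:\mathbb{N}\to\mathbb{N}$ with $f(n)/n\to \frac{1}{12}$ and $g(n)/n\to 2$ as $n\to\infty$ such that, for every sufficiently large $n$, the hypercube $Q_n$ contains $f(n)$ pairwise completely independent spanning trees, each of diameter at most $g(n)$. (In short: there exist $(\frac1{12}+o(1))n$ completely independent spanning trees in $Q_n$, each with diameter $(2+o(1))n$.)
   Context: The hypercube $Q_n$ has vertex set $\{0,1\}^n$, two vertices being adjacent if they differ in exactly one coordinate. Two spanning trees of a graph $G$ are completely independent if they have no edge in common and, for every pair of vertices $u,v$ of $G$, the $u$–$v$ paths in the two trees have no vertex in common other than $u$ and $v$. A set of spanning trees is completely independent if its members are pairwise completely independent. The diameter of a tree is the maximum distance between two of its vertices within the tree. -}

module Defs where

open import Data.Nat using (ℕ; zero; suc; _+_; _*_; _≤_; _<_; _≥_; ∣_-_∣)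
open import Data.Bool using (Bool; not)
open import Data.Vec using (Vec; _[_]%=_)
open import Data.Fin using (Fin)
open import Data.List using (List; []; _∷_; [_]; length)
open import Data.List.Membership.Propositional using (_∈_)
open import Data.List.Relation.Unary.Unique.Propositional using (Unique)
open import Data.Product using (Σ; ∃; ∃-syntax; _×_; _,_)
open import Data.Sum using (_⊎_)
open import Data.Empty using (⊥)
open import Relation.Nullary using (¬_)
open import Relation.Binary.PropositionalEquality using (_≡_; _≢_)

-- f(n)/n → p/q  (q > 0), written out with ε = 1/(k+1):
-- ∀ k ∃ N ∀ n ≥ N, |f(n)/n − p/q| < 1/(k+1),
-- i.e. (after multiplying by q·n·(k+1)) (k+1)·|q·f(n) − p·n| < q·n.
RatioTendsTo : (ℕ → ℕ) → ℕ → ℕ → Set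
RatioTendsTo f p q =
  ∀ (k : ℕ) → ∃[ N ] ∀ (n : ℕ) → n ≥ N →
    suc k * ∣ q * f n - p * n ∣ < q * n

Vertex : ℕ → Set
Vertex n = Vec Bool n

Adj : ∀ {n} → Vertex n → Vertex n → Set
Adj {n} u v = ∃[ i ] (v ≡ (u [ i ]%= not))

data Walk {V : Set} (E : V → V → Set) : V → V → List V → Set where
  here : ∀ u → Walk E u u [ u ]
  step : ∀ {u w v vs} → E u w → Walk E w v vs → Walk E u v (u ∷ vs)

Path : {V : Set} (E : V → V → Set) → V → V → List V → Set
Path E u v vs = Walk E u v vs × Unique vs

HasCycle : {V : Set} (E : V → V → Set) → Set
HasCycle {V} E = ∃[ u ] ∃[ v ] ∃[ vs ]
  (Path E u v vs × 3 ≤ length vs × E v u)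

record SpanningTree (n : ℕ) : Set₁ where
  field
    edge      : Vertex n → Vertex n → Set
    sub       : ∀ {u v} → edge u v → Adj u v
    symm      : ∀ {u v} → edge u v → edge v u
    connected : ∀ u v → ∃[ vs ] Walk edge u v vs
    acyclic   : ¬ HasCycle edge
open SpanningTree public

DiameterAtMost : ∀ {n} → SpanningTree n → ℕ → Set
DiameterAtMost {n} T d = ∀ (u v : Vertex n) →
  ∃[ vs ] (Walk (edge T) u v vs × length vs ≤ suc d)

CompletelyIndependent : ∀ {n} → SpanningTree n → SpanningTree n → Set
CompletelyIndependent {n} T₁ T₂ =
  (∀ (u v : Vertex n) → edge T₁ u v → edge T₂ u v → ⊥) ×
  (∀ (u v : Vertex n) (vs ws : List (Vertex n)) →
     Path (edge T₁) u v vs → Path (edge T₂) u v ws →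
     ∀ x → x ∈ vs → x ∈ ws → x ≡ u ⊎ x ≡ v)

PairwiseCI : ∀ {n m} → (Fin m → SpanningTree n) → Set
PairwiseCI {n} {m} ts = ∀ (i j : Fin m) → i ≢ j → CompletelyIndependent (ts i) (ts j)

module Submission where

-- Choose k with ⌊n/12⌋ ≤ 2^k ≤ 2⌊n/12⌋ + 1 and write n = 1 + 2A + e with A = 2^(k+1); split the
-- last n − 1 coordinates of a vertex z ∷ xs into regions C and D of size A and E of size e. Each
-- position of C and of D carries a label in {0,1}^k, every label occurring twice in each region,
-- and the type of z ∷ xs is the xor of the labels of the positions set in xs within C if z = 0,
-- within D if z = 1. For each type σ there is a spanning tree all of whose internal vertices have
-- type σ: vertices of type σ reach a root of type σ by flipping coordinates outside the region
-- that defines the type, or the leading bit once the other region agrees with the root; every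
-- other vertex is a leaf, attached by flipping a position labelled (its type) xor σ.
-- Trees with disjoint sets of internal vertices are completely independent as soon as they share
-- no edge, and the two copies of each label let the trees of types σ ≠ τ attach their leaves
-- along different positions. Every vertex is within n + 2 steps of the root, so the diameter is
-- at most 2n + 4.

open import Data.Bool using (Bool; true; false; not; _xor_; if_then_else_)
open import Data.Bool.Properties
  using (not-involutive; not-¬; xor-comm; xor-assoc; xor-identityˡ; xor-identityʳ; xor-same)
  renaming (_≟_ to _≟B_)
open import Data.Empty using (⊥; ⊥-elim)
open import Data.Fin using (Fin; zero; suc; inject≤; splitAt; _↑ˡ_; _↑ʳ_)
open import Data.Fin.Properties
  using (inject≤-injective; ↑ˡ-injective; ↑ʳ-injective; splitAt-↑ˡ; splitAt-↑ʳ; splitAt⁻¹-↑ˡ; splitAt⁻¹-↑ʳ)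
open import Data.List using (List; _∷_; [_]; length; _++_; drop; reverse)
open import Data.List.Membership.Propositional using (_∈_)
open import Data.List.Properties using (unfold-reverse; length-reverse)
open import Data.List.Relation.Binary.Permutation.Propositional using (↭-sym; ↭⇒↭ₛ)
open import Data.List.Relation.Binary.Permutation.Propositional.Properties using (↭-reverse)
import Data.List.Relation.Binary.Permutation.Setoid.Properties as Permutation
import Data.List.Relation.Unary.All as All
open import Data.List.Relation.Unary.AllPairs using (_∷_)
open import Data.List.Relation.Unary.Any using (here; there)
open import Data.List.Relation.Unary.Unique.Propositional using (Unique)
open import Data.Nat using (ℕ; zero; suc; _+_; _*_; _∸_; _/_; _%_; ∣_-_∣; _≤_; _<_; _≥_; _≤?_; z≤n; s≤s)
open import Data.Nat.DivMod using (m/n*n≤m; m%n<n; m≡m%n+[m/n]*n)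
open import Data.Nat.Properties
  using ( module ≤-Reasoning; ≤-refl; ≤-reflexive; ≤-trans; ≤-antisym; ≤-pred; <-trans; <-irrefl; ≰⇒>
        ; n≤1+n; m≤m+n; 0≢1+n; +-suc; +-comm; +-assoc; +-identityʳ; +-mono-≤; +-monoˡ-≤; +-monoʳ-≤
        ; *-comm; *-identityˡ; *-monoʳ-≤; *-monoʳ-<; *-cancelˡ-≤; m+[n∸m]≡n; ∣m-m+n∣≡n; ∣-∣-comm)
open import Data.Nat.Tactic.RingSolver using (solve-∀)
open import Data.Product using (∃-syntax; _×_; _,_; proj₁; proj₂)
open import Data.Sum using (_⊎_; inj₁; inj₂)
open import Data.Vec using (Vec; []; _∷_; _[_]%=_; lookup; head; tail; zipWith; replicate)
open import Data.Vec.Properties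
  using ( ≡-dec; lookup∘updateAt; lookup∘updateAt′; updateAt-updateAt; updateAt-cong; updateAt-id
        ; zipWith-comm; zipWith-assoc; zipWith-identityˡ; zipWith-identityʳ)
open import Data.Vec.Relation.Binary.Pointwise.Extensional using (ext; Pointwise-≡⇒≡)
open import Function using (_∘_)
open import Relation.Binary.PropositionalEquality
  using (_≡_; _≢_; refl; sym; trans; cong; cong₂; subst; setoid; module ≡-Reasoning)
open import Relation.Nullary using (¬_; Dec; yes; no)

open import Defs

-- Spanning trees from rank-decreasing parent functions

_≟V_ : ∀ {n} (u v : Vec Bool n) → Dec (u ≡ v)
_≟V_ = ≡-dec _≟B_

Adj-sym : ∀ {n} {u v : Vertex n} → Adj u v → Adj v u
Adj-sym {u = u} (i , refl) =
  i , sym (trans (updateAt-updateAt i u) (trans (updateAt-cong i not-involutive u) (updateAt-id i u)))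

Unique-reverse : ∀ {A : Set} {xs : List A} → Unique xs → Unique (reverse xs)
Unique-reverse {A} {xs} = Permutation.Unique-resp-↭ (setoid A) (↭⇒↭ₛ (↭-sym (↭-reverse xs)))

record RankedParent (n h : ℕ) : Set where
  field
    parent      : Vertex n → Vertex n
    root        : Vertex n
    rank        : Vertex n → ℕ
    parent-adj  : ∀ x → x ≢ root → Adj x (parent x)
    rank-parent : ∀ x → x ≢ root → rank (parent x) < rank x
    rank≤       : ∀ x → rank x ≤ h

module RankedParentTree {n h : ℕ} (T : RankedParent n h) where
  open RankedParent T

  Child : Vertex n → Vertex n → Set
  Child c x = c ≢ root × parent c ≡ x

  Edge : Vertex n → Vertex n → Set
  Edge u v = Child u v ⊎ Child v u

  Internal : Vertex n → Set
  Internal x = ∃[ c ] Child c x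

  rank-child : ∀ {c x} → Child c x → rank x < rank c
  rank-child (c≢root , refl) = rank-parent _ c≢root

  Edge-sym : ∀ {u v} → Edge u v → Edge v u
  Edge-sym (inj₁ c) = inj₂ c
  Edge-sym (inj₂ c) = inj₁ c

  Edge-adj : ∀ {u v} → Edge u v → Adj u v
  Edge-adj (inj₁ (c≢root , refl)) = parent-adj _ c≢root
  Edge-adj (inj₂ (c≢root , refl)) = Adj-sym (parent-adj _ c≢root)

  walk-++ : ∀ {u w v xs ys} → Walk Edge u w xs → Walk Edge w v ys → Walk Edge u v (xs ++ drop 1 ys)
  walk-++ (here _) (here _)   = here _
  walk-++ (here _) (step e q) = step e q
  walk-++ (step e p) q        = step e (walk-++ p q)

  length-walk-++ : ∀ {u w v xs ys} → Walk Edge u w xs → Walk Edge w v ys →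
                   suc (length (xs ++ drop 1 ys)) ≤ length xs + length ys
  length-walk-++ (here _) (here _)   = ≤-refl
  length-walk-++ (here _) (step _ _) = ≤-refl
  length-walk-++ (step _ p) q        = s≤s (length-walk-++ p q)

  walk-reverse : ∀ {u v vs} → Walk Edge u v vs → Walk Edge v u (reverse vs)
  walk-reverse (here u) = here u
  walk-reverse {u} (step {vs = vs} e p) =
    subst (Walk Edge _ u) (sym (unfold-reverse u vs)) (walk-++ (walk-reverse p) (step (Edge-sym e) (here u)))

  walk-to-root : ∀ k x → rank x ≤ k → ∃[ vs ] (Walk Edge x root vs × length vs ≤ suc k)
  walk-to-root k x rank≤k with x ≟V root
  ... | yes refl = [ root ] , here root , s≤s z≤n
  walk-to-root zero x rank≤0 | no x≢root with ≤-trans (rank-parent x x≢root) rank≤0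
  ... | ()
  walk-to-root (suc k) x rank≤k | no x≢root
    with walk-to-root k (parent x) (≤-pred (≤-trans (rank-parent x x≢root) rank≤k))
  ... | vs , w , len = x ∷ vs , step (inj₁ (x≢root , refl)) w , s≤s len

  start∈ : ∀ {a b vs} → Walk Edge a b vs → a ∈ vs
  start∈ (here _)   = here refl
  start∈ (step _ _) = here refl

  end∈ : ∀ {a b vs} → Walk Edge a b vs → b ∈ vs
  end∈ (here _)   = here refl
  end∈ (step _ w) = there (end∈ w)

  -- Having stepped down to a child, a path can never climb back through x, so it keeps descending.
  rank-path-from-child : ∀ {c v x cs} → Walk Edge c v cs → Unique (x ∷ cs) → Child c x → rank x < rank v
  rank-path-from-child (here _) _ c = rank-child c
  rank-path-from-child (step (inj₁ c′) w) (x∉ ∷ _) c =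
    ⊥-elim (All.lookup x∉ (there (start∈ w)) (trans (sym (proj₂ c)) (proj₂ c′)))
  rank-path-from-child (step (inj₂ c′) w) (_ ∷ uq) c = <-trans (rank-child c) (rank-path-from-child w uq c′)

  no-long-path-to-parent : ∀ {u v vs} → Path Edge u v vs → 3 ≤ length vs → ¬ Child u v
  no-long-path-to-parent (here _ , _) (s≤s ()) _
  no-long-path-to-parent (step (inj₁ _) (here _) , _) (s≤s (s≤s ())) _
  no-long-path-to-parent (step (inj₁ c′) (step _ w) , _ ∷ (w∉ ∷ _)) _ c =
    All.lookup w∉ (end∈ w) (trans (sym (proj₂ c′)) (proj₂ c))
  no-long-path-to-parent (step (inj₂ c′) w , uq) _ c =
    <-irrefl refl (<-trans (rank-path-from-child w uq c′) (rank-child c))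

  path-reverse : ∀ {u v vs} → Path Edge u v vs → Path Edge v u (reverse vs)
  path-reverse (w , uq) = walk-reverse w , Unique-reverse uq

  Edge-acyclic : ¬ HasCycle Edge
  Edge-acyclic (u , v , vs , p , 3≤ , inj₁ v↦u) =
    no-long-path-to-parent (path-reverse p) (subst (3 ≤_) (sym (length-reverse vs)) 3≤) v↦u
  Edge-acyclic (u , v , vs , p , 3≤ , inj₂ u↦v) = no-long-path-to-parent p 3≤ u↦v

  walk-via-root : ∀ u v → ∃[ vs ] (Walk Edge u v vs × length vs ≤ suc (h + h))
  walk-via-root u v with walk-to-root h u (rank≤ u) | walk-to-root h v (rank≤ v)
  ... | us , p , |us|≤ | vs , q , |vs|≤ =
    _ , walk-++ p (walk-reverse q) ,
    ≤-pred (begin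
      suc (length (us ++ drop 1 (reverse vs)))  ≤⟨ length-walk-++ p (walk-reverse q) ⟩
      length us + length (reverse vs)          ≡⟨ cong (length us +_) (length-reverse vs) ⟩
      length us + length vs                    ≤⟨ +-mono-≤ |us|≤ |vs|≤ ⟩
      suc h + suc h                            ≡⟨ cong suc (+-suc h h) ⟩
      suc (suc (h + h))                        ∎)
    where open ≤-Reasoning

  spanningTree : SpanningTree n
  spanningTree = record
    { edge      = Edge
    ; sub       = Edge-adj
    ; symm      = Edge-sym
    ; connected = λ u v → let vs , w , _ = walk-via-root u v in vs , w
    ; acyclic   = Edge-acyclic }

  spanningTree-diameter : DiameterAtMost spanningTree (h + h)
  spanningTree-diameter = walk-via-root

  -- Of the two path-neighbours of an inner vertex x, at most one is parent x; the other is a child.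
  path-inner-internal : ∀ {u v vs x} → Path Edge u v vs → x ∈ vs → x ≢ u → x ≢ v → Internal x
  path-inner-internal (here _ , _)   (here refl) x≢u _ = ⊥-elim (x≢u refl)
  path-inner-internal (step _ _ , _) (here refl) x≢u _ = ⊥-elim (x≢u refl)
  path-inner-internal {x = x} (step {w = w} _ p , _ ∷ uq) (there x∈) _ x≢v with x ≟V w
  ... | no x≢w = path-inner-internal (p , uq) x∈ x≢w x≢v
  path-inner-internal (step _ (here _) , _) _ _ x≢v | yes refl = ⊥-elim (x≢v refl)
  path-inner-internal (step (inj₁ u↦x) (step _ _) , _) _ _ _ | yes refl = _ , u↦x
  path-inner-internal (step (inj₂ _) (step (inj₂ y↦x) _) , _) _ _ _ | yes refl = _ , y↦x
  path-inner-internal (step (inj₂ x↦u) (step (inj₁ x↦y) p) , u∉ ∷ _) _ _ _ | yes refl =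
    ⊥-elim (All.lookup u∉ (there (start∈ p)) (trans (sym (proj₂ x↦u)) (proj₂ x↦y)))

module CompletelyIndependentFamily {n h m : ℕ} (T : Fin m → RankedParent n h)
  (internal-disjoint : ∀ i j {x} → RankedParentTree.Internal (T i) x → RankedParentTree.Internal (T j) x → i ≡ j)
  (no-crossing : ∀ i j {u v} → i ≢ j → RankedParentTree.Child (T i) u v → ¬ RankedParentTree.Child (T j) v u) where

  open RankedParentTree using (Child; Edge; spanningTree; path-inner-internal)

  trees : Fin m → SpanningTree n
  trees i = spanningTree (T i)

  no-common-edge : ∀ i j → i ≢ j → ∀ u v → Edge (T i) u v → Edge (T j) u v → ⊥
  no-common-edge i j i≢j u v (inj₁ a) (inj₁ b) = i≢j (internal-disjoint i j (_ , a) (_ , b))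
  no-common-edge i j i≢j u v (inj₁ a) (inj₂ b) = no-crossing i j i≢j a b
  no-common-edge i j i≢j u v (inj₂ a) (inj₁ b) = no-crossing j i (λ j≡i → i≢j (sym j≡i)) b a
  no-common-edge i j i≢j u v (inj₂ a) (inj₂ b) = i≢j (internal-disjoint i j (_ , a) (_ , b))

  trees-pairwiseCI : PairwiseCI trees
  trees-pairwiseCI i j i≢j = no-common-edge i j i≢j , paths-meet-at-ends
    where
    paths-meet-at-ends : ∀ u v vs ws → Path (Edge (T i)) u v vs → Path (Edge (T j)) u v ws →
                         ∀ x → x ∈ vs → x ∈ ws → x ≡ u ⊎ x ≡ v
    paths-meet-at-ends u v vs ws p q x x∈vs x∈ws with x ≟V u | x ≟V v
    ... | yes x≡u | _       = inj₁ x≡u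
    ... | no _    | yes x≡v = inj₂ x≡v
    ... | no x≢u  | no x≢v  = ⊥-elim (i≢j (internal-disjoint i j
                                 (path-inner-internal (T i) p x∈vs x≢u x≢v)
                                 (path-inner-internal (T j) q x∈ws x≢u x≢v)))

CIFamily : ℕ → ℕ → ℕ → Set₁
CIFamily n m d = ∃[ ts ] (PairwiseCI {n} {m} ts × (∀ i → DiameterAtMost (ts i) d))

pow2 : ℕ → ℕ
pow2 zero    = 1
pow2 (suc k) = pow2 k + pow2 k

toBits : ∀ k → Fin (pow2 k) → Vec Bool k
toBits zero    _ = []
toBits (suc k) j with splitAt (pow2 k) j
... | inj₁ a = false ∷ toBits k a
... | inj₂ b = true ∷ toBits k b

fromBits : ∀ {k} → Vec Bool k → Fin (pow2 k)
fromBits []                  = zero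
fromBits {suc k} (false ∷ h) = fromBits h ↑ˡ pow2 k
fromBits {suc k} (true ∷ h)  = pow2 k ↑ʳ fromBits h

toBits-fromBits : ∀ {k} (h : Vec Bool k) → toBits k (fromBits h) ≡ h
toBits-fromBits [] = refl
toBits-fromBits {suc k} (false ∷ h) rewrite splitAt-↑ˡ (pow2 k) (fromBits h) (pow2 k) =
  cong (false ∷_) (toBits-fromBits h)
toBits-fromBits {suc k} (true ∷ h) rewrite splitAt-↑ʳ (pow2 k) (pow2 k) (fromBits h) =
  cong (true ∷_) (toBits-fromBits h)

fromBits-toBits : ∀ k (j : Fin (pow2 k)) → fromBits (toBits k j) ≡ j
fromBits-toBits zero zero = refl
fromBits-toBits (suc k) j with splitAt (pow2 k) j in eq
... | inj₁ a = trans (cong (_↑ˡ pow2 k) (fromBits-toBits k a)) (splitAt⁻¹-↑ˡ eq)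
... | inj₂ b = trans (cong (pow2 k ↑ʳ_) (fromBits-toBits k b)) (splitAt⁻¹-↑ʳ eq)

toBits-injective : ∀ k {i j : Fin (pow2 k)} → toBits k i ≡ toBits k j → i ≡ j
toBits-injective k {i} {j} eq = trans (sym (fromBits-toBits k i)) (trans (cong fromBits eq) (fromBits-toBits k j))

fromBits-injective : ∀ {k} {u v : Vec Bool k} → fromBits u ≡ fromBits v → u ≡ v
fromBits-injective {k} {u} {v} eq = trans (sym (toBits-fromBits u)) (trans (cong (toBits k) eq) (toBits-fromBits v))

_⊕_ : ∀ {k} → Vec Bool k → Vec Bool k → Vec Bool k
_⊕_ = zipWith _xor_

zeros : ∀ {k} → Vec Bool k
zeros = replicate _ false

⊕-comm : ∀ {k} (a b : Vec Bool k) → a ⊕ b ≡ b ⊕ a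
⊕-comm = zipWith-comm xor-comm

⊕-assoc : ∀ {k} (a b c : Vec Bool k) → (a ⊕ b) ⊕ c ≡ a ⊕ (b ⊕ c)
⊕-assoc = zipWith-assoc xor-assoc

⊕-identityˡ : ∀ {k} (a : Vec Bool k) → zeros ⊕ a ≡ a
⊕-identityˡ = zipWith-identityˡ xor-identityˡ

⊕-identityʳ : ∀ {k} (a : Vec Bool k) → a ⊕ zeros ≡ a
⊕-identityʳ = zipWith-identityʳ xor-identityʳ

⊕-self : ∀ {k} (a : Vec Bool k) → a ⊕ a ≡ zeros
⊕-self []      = refl
⊕-self (x ∷ a) = cong₂ _∷_ (xor-same x) (⊕-self a)

⊕-cancelˡ : ∀ {k} (a b : Vec Bool k) → a ⊕ (a ⊕ b) ≡ b
⊕-cancelˡ a b = begin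
  a ⊕ (a ⊕ b)  ≡⟨ ⊕-assoc a a b ⟨
  (a ⊕ a) ⊕ b  ≡⟨ cong (_⊕ b) (⊕-self a) ⟩
  zeros ⊕ b    ≡⟨ ⊕-identityˡ b ⟩
  b            ∎
  where open ≡-Reasoning

syndrome : ∀ {k L} → (Fin L → Vec Bool k) → Vec Bool L → Vec Bool k
syndrome w []       = zeros
syndrome w (b ∷ xs) = (if b then w zero else zeros) ⊕ syndrome (w ∘ suc) xs

syndrome-flip : ∀ {k L} (w : Fin L → Vec Bool k) xs t → syndrome w (xs [ t ]%= not) ≡ syndrome w xs ⊕ w t
syndrome-flip w (true ∷ xs) zero = begin
  zeros ⊕ s              ≡⟨ ⊕-identityˡ s ⟩
  s                      ≡⟨ ⊕-cancelˡ (w zero) s ⟨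
  w zero ⊕ (w zero ⊕ s)  ≡⟨ cong (w zero ⊕_) (⊕-comm (w zero) s) ⟩
  w zero ⊕ (s ⊕ w zero)  ≡⟨ ⊕-assoc (w zero) s (w zero) ⟨
  (w zero ⊕ s) ⊕ w zero  ∎
  where open ≡-Reasoning; s = syndrome (w ∘ suc) xs
syndrome-flip w (false ∷ xs) zero =
  trans (⊕-comm (w zero) s) (cong (_⊕ w zero) (sym (⊕-identityˡ s)))
  where s = syndrome (w ∘ suc) xs
syndrome-flip w (b ∷ xs) (suc t) =
  trans (cong (c ⊕_) (syndrome-flip (w ∘ suc) xs t)) (sym (⊕-assoc c (syndrome (w ∘ suc) xs) (w (suc t))))
  where c = if b then w zero else zeros

syndrome-zeros : ∀ {k L} (w : Fin L → Vec Bool k) → syndrome w zeros ≡ zeros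
syndrome-zeros {L = zero}  w = refl
syndrome-zeros {L = suc L} w = trans (⊕-identityˡ _) (syndrome-zeros (w ∘ suc))

syndrome-cong : ∀ {k L} (w : Fin L → Vec Bool k) xs ys →
                (∀ t → lookup xs t ≡ lookup ys t ⊎ w t ≡ zeros) → syndrome w xs ≡ syndrome w ys
syndrome-cong w []       []       _  = refl
syndrome-cong w (x ∷ xs) (y ∷ ys) eq = cong₂ _⊕_ head-term (syndrome-cong (w ∘ suc) xs ys (eq ∘ suc))
  where
  if-zeros : ∀ b → w zero ≡ zeros → (if b then w zero else zeros) ≡ zeros
  if-zeros true  w₀≡0 = w₀≡0
  if-zeros false _    = refl
  head-term : (if x then w zero else zeros) ≡ (if y then w zero else zeros)
  head-term with eq zero
  ... | inj₁ refl = refl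
  ... | inj₂ w₀≡0 = trans (if-zeros x w₀≡0) (sym (if-zeros y w₀≡0))

firstBit : ∀ {k} → Vec Bool k → Vec Bool k → Bool
firstBit []       []       = false
firstBit (a ∷ as) (b ∷ bs) with a ≟B b
... | yes _ = firstBit as bs
... | no _  = a

firstBit-asym : ∀ {k} (σ τ : Vec Bool k) → σ ≢ τ → firstBit σ τ ≢ firstBit τ σ
firstBit-asym []       []       σ≢τ = ⊥-elim (σ≢τ refl)
firstBit-asym (a ∷ as) (b ∷ bs) σ≢τ with a ≟B b | b ≟B a
... | yes refl | yes _    = firstBit-asym as bs (σ≢τ ∘ cong (a ∷_))
... | yes refl | no b≢a   = ⊥-elim (b≢a refl)
... | no a≢b   | yes b≡a  = ⊥-elim (a≢b (sym b≡a))
... | no a≢b   | no _     = a≢b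

-- Distances within regions of coordinates

data Region : Set where
  RC RD RE : Region

_≟R_ : (a b : Region) → Dec (a ≡ b)
RC ≟R RC = yes refl
RC ≟R RD = no λ ()
RC ≟R RE = no λ ()
RD ≟R RC = no λ ()
RD ≟R RD = yes refl
RD ≟R RE = no λ ()
RE ≟R RC = no λ ()
RE ≟R RD = no λ ()
RE ≟R RE = yes refl

AgreeOn : ∀ {L} → (Fin L → Region) → Region → Vec Bool L → Vec Bool L → Set
AgreeOn g R xs ys = ∀ t → g t ≡ R → lookup xs t ≡ lookup ys t

DisagreeIn : ∀ {L} → (Fin L → Region) → Region → Vec Bool L → Vec Bool L → Set
DisagreeIn g R xs ys = ∃[ t ] (g t ≡ R × lookup xs t ≢ lookup ys t)

disagreeIn-or-agreeOn : ∀ {L} (g : Fin L → Region) R xs ys → DisagreeIn g R xs ys ⊎ AgreeOn g R xs ys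
disagreeIn-or-agreeOn g R []       []       = inj₂ λ ()
disagreeIn-or-agreeOn g R (a ∷ as) (b ∷ bs) with g zero ≟R R | a ≟B b | disagreeIn-or-agreeOn (g ∘ suc) R as bs
... | yes g₀≡R | no a≢b | _                   = inj₁ (zero , g₀≡R , a≢b)
... | _        | _      | inj₁ (t , gt≡R , d) = inj₁ (suc t , gt≡R , d)
... | yes _    | yes a≡b | inj₂ agree = inj₂ λ { zero _ → a≡b ; (suc t) → agree t }
... | no g₀≢R  | _       | inj₂ agree = inj₂ λ { zero g₀≡R → ⊥-elim (g₀≢R g₀≡R) ; (suc t) → agree t }

bitDist : Bool → Bool → ℕ
bitDist a b = if a xor b then 1 else 0

positionDist : Region → Region → Bool → Bool → ℕ
positionDist r R a b with r ≟R R
... | yes _ = bitDist a b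
... | no _  = 0

regionDist : ∀ {L} → (Fin L → Region) → Region → Vec Bool L → Vec Bool L → ℕ
regionDist g R []       []       = 0
regionDist g R (a ∷ as) (b ∷ bs) = positionDist (g zero) R a b + regionDist (g ∘ suc) R as bs

regionDist-flip-in : ∀ {L} (g : Fin L → Region) R xs ys t → g t ≡ R → lookup xs t ≢ lookup ys t →
                     regionDist g R xs ys ≡ suc (regionDist g R (xs [ t ]%= not) ys)
regionDist-flip-in g R (a ∷ as) (b ∷ bs) zero g₀≡R a≢b with g zero ≟R R
... | no g₀≢R = ⊥-elim (g₀≢R g₀≡R)
... | yes _   = cong (_+ regionDist (g ∘ suc) R as bs) (flip-closer a b a≢b)
  where
  flip-closer : ∀ a b → a ≢ b → bitDist a b ≡ suc (bitDist (not a) b)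
  flip-closer false false a≢b = ⊥-elim (a≢b refl)
  flip-closer false true  _   = refl
  flip-closer true  false _   = refl
  flip-closer true  true  a≢b = ⊥-elim (a≢b refl)
regionDist-flip-in g R (a ∷ as) (b ∷ bs) (suc t) gt≡R d =
  trans (cong (positionDist (g zero) R a b +_) (regionDist-flip-in (g ∘ suc) R as bs t gt≡R d)) (+-suc _ _)

regionDist-flip-out : ∀ {L} (g : Fin L → Region) R xs ys t → g t ≢ R →
                      regionDist g R (xs [ t ]%= not) ys ≡ regionDist g R xs ys
regionDist-flip-out g R (a ∷ as) (b ∷ bs) zero g₀≢R with g zero ≟R R
... | yes g₀≡R = ⊥-elim (g₀≢R g₀≡R)
... | no _     = refl
regionDist-flip-out g R (a ∷ as) (b ∷ bs) (suc t) gt≢R =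
  cong (positionDist (g zero) R a b +_) (regionDist-flip-out (g ∘ suc) R as bs t gt≢R)

regionDist-agree : ∀ {L} (g : Fin L → Region) R xs ys → AgreeOn g R xs ys → regionDist g R xs ys ≡ 0
regionDist-agree g R []       []       _     = refl
regionDist-agree g R (a ∷ as) (b ∷ bs) agree with g zero ≟R R
... | no _     = regionDist-agree (g ∘ suc) R as bs (agree ∘ suc)
... | yes g₀≡R rewrite agree zero g₀≡R | xor-same b = regionDist-agree (g ∘ suc) R as bs (agree ∘ suc)

regionDist-total : ∀ {L} (g : Fin L → Region) xs ys →
                   regionDist g RC xs ys + regionDist g RD xs ys + regionDist g RE xs ys ≤ L
regionDist-total g []       []       = z≤n
regionDist-total {suc L} g (a ∷ as) (b ∷ bs) =
  subst (_≤ suc L) (sym (interchange (pd RC) (pd RD) (pd RE) _ _ _))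
    (+-mono-≤ (position≤1 (g zero)) (regionDist-total (g ∘ suc) as bs))
  where
  pd : Region → ℕ
  pd R = positionDist (g zero) R a b
  bitDist≤1 : bitDist a b ≤ 1
  bitDist≤1 with a xor b
  ... | true  = ≤-refl
  ... | false = z≤n
  position≤1 : ∀ r → positionDist r RC a b + positionDist r RD a b + positionDist r RE a b ≤ 1
  position≤1 RC rewrite +-identityʳ (bitDist a b) = subst (_≤ 1) (sym (+-identityʳ _)) bitDist≤1
  position≤1 RD rewrite +-identityʳ (bitDist a b) = bitDist≤1
  position≤1 RE = bitDist≤1
  interchange : ∀ a b c x y z → (a + x) + (b + y) + (c + z) ≡ (a + b + c) + (x + y + z)
  interchange = solve-∀

-- The trees

home : Bool → Region
home false = RC
home true  = RD

home-not≢home : ∀ z → home (not z) ≢ home z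
home-not≢home false ()
home-not≢home true  ()

RE≢home : ∀ z → RE ≢ home z
RE≢home false ()
RE≢home true  ()

module Construction (k e : ℕ) where

  A : ℕ
  A = pow2 (suc k)

  L : ℕ
  L = A + (A + e)

  region : Fin L → Region
  region t with splitAt A t
  ... | inj₁ _ = RC
  ... | inj₂ t′ with splitAt A t′
  ...   | inj₁ _ = RD
  ...   | inj₂ _ = RE

  label : Fin A → Vec Bool k
  label j = tail (toBits (suc k) j)

  weight : Bool → Fin L → Vec Bool k
  weight false t with splitAt A t
  ... | inj₁ j = label j
  ... | inj₂ _ = zeros
  weight true t with splitAt A t
  ... | inj₁ _ = zeros
  ... | inj₂ t′ with splitAt A t′
  ...   | inj₁ j = label j
  ...   | inj₂ _ = zeros

  weight-outside : ∀ z t → region t ≢ home z → weight z t ≡ zeros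
  weight-outside false t out with splitAt A t
  ... | inj₁ _ = ⊥-elim (out refl)
  ... | inj₂ _ = refl
  weight-outside true t out with splitAt A t
  ... | inj₁ _ = refl
  ... | inj₂ t′ with splitAt A t′
  ...   | inj₁ _ = ⊥-elim (out refl)
  ...   | inj₂ _ = refl

  slot : Bool → Bool → Vec Bool k → Fin L
  slot false b h = fromBits (b ∷ h) ↑ˡ (A + e)
  slot true  b h = A ↑ʳ (fromBits (b ∷ h) ↑ˡ e)

  weight-slot : ∀ z b h → weight z (slot z b h) ≡ h
  weight-slot false b h rewrite splitAt-↑ˡ A (fromBits (b ∷ h)) (A + e) =
    cong tail (toBits-fromBits (b ∷ h))
  weight-slot true b h rewrite splitAt-↑ʳ A (A + e) (fromBits (b ∷ h) ↑ˡ e)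
                             | splitAt-↑ˡ A (fromBits (b ∷ h)) e =
    cong tail (toBits-fromBits (b ∷ h))

  weight-slot-not : ∀ z b h → weight (not z) (slot z b h) ≡ zeros
  weight-slot-not false b h rewrite splitAt-↑ˡ A (fromBits (b ∷ h)) (A + e) = refl
  weight-slot-not true b h rewrite splitAt-↑ʳ A (A + e) (fromBits (b ∷ h) ↑ˡ e) = refl

  slot-bit-injective : ∀ z {b h b′ h′} → slot z b h ≡ slot z b′ h′ → b ≡ b′
  slot-bit-injective z {b} {h} {b′} {h′} eq =
    cong head (fromBits-injective {u = b ∷ h} {v = b′ ∷ h′} (bits-eq z eq))
    where
    bits-eq : ∀ z {b h b′ h′} → slot z b h ≡ slot z b′ h′ → fromBits (b ∷ h) ≡ fromBits (b′ ∷ h′)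
    bits-eq false eq = ↑ˡ-injective (A + e) _ _ eq
    bits-eq true  eq = ↑ˡ-injective e _ _ (↑ʳ-injective A _ _ eq)

  V : Set
  V = Vertex (suc L)

  type : V → Vec Bool k
  type (z ∷ xs) = syndrome (weight z) xs

  flip-outside-type : ∀ z xs t → region t ≢ home z → type (z ∷ (xs [ t ]%= not)) ≡ type (z ∷ xs)
  flip-outside-type z xs t out =
    trans (syndrome-flip (weight z) xs t) (trans (cong (_ ⊕_) (weight-outside z t out)) (⊕-identityʳ _))

  module TreeOfType (σ : Vec Bool k) where

    base : Vec Bool L
    base = (zeros [ slot false false σ ]%= not) [ slot true false σ ]%= not

    base-syndrome : ∀ z → syndrome (weight z) base ≡ σ
    base-syndrome z = begin
      syndrome w base                              ≡⟨ syndrome-flip w (zeros [ p ]%= not) q ⟩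
      syndrome w (zeros [ p ]%= not) ⊕ w q          ≡⟨ cong (_⊕ w q) (syndrome-flip w zeros p) ⟩
      (syndrome w zeros ⊕ w p) ⊕ w q                ≡⟨ cong (λ s → (s ⊕ w p) ⊕ w q) (syndrome-zeros w) ⟩
      (zeros ⊕ w p) ⊕ w q                           ≡⟨ cong (_⊕ w q) (⊕-identityˡ (w p)) ⟩
      w p ⊕ w q                                     ≡⟨ slots z ⟩
      σ                                             ∎
      where
      open ≡-Reasoning
      w = weight z
      p = slot false false σ
      q = slot true false σ
      slots : ∀ z → weight z (slot false false σ) ⊕ weight z (slot true false σ) ≡ σ
      slots false rewrite weight-slot false false σ | weight-slot-not true false σ = ⊕-identityʳ σ
      slots true rewrite weight-slot-not false false σ | weight-slot true false σ = ⊕-identityˡ σ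

    root : V
    root = false ∷ base

    agree-type : ∀ z xs → AgreeOn region (home z) xs base → type (z ∷ xs) ≡ σ
    agree-type z xs agree = trans (syndrome-cong (weight z) xs base agree-or-zero) (base-syndrome z)
      where
      agree-or-zero : ∀ t → lookup xs t ≡ lookup base t ⊎ weight z t ≡ zeros
      agree-or-zero t with region t ≟R home z
      ... | yes in-home = inj₁ (agree t in-home)
      ... | no out      = inj₂ (weight-outside z t out)

    dist : Region → Vec Bool L → ℕ
    dist R xs = regionDist region R xs base

    Comparison : Region → Vec Bool L → Set
    Comparison R xs = DisagreeIn region R xs base ⊎ AgreeOn region R xs base

    compare : ∀ R xs → Comparison R xs
    compare R xs = disagreeIn-or-agreeOn region R xs base

    -- An inner vertex z ∷ xs moves towards the root by repairing region E, then the region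
    -- home (not z) that does not affect its type, and finally by flipping its leading bit.
    innerStep : ∀ z xs → Comparison RE xs → Comparison (home (not z)) xs → V
    innerStep z xs (inj₁ (t , _)) _              = z ∷ (xs [ t ]%= not)
    innerStep z xs (inj₂ _)       (inj₁ (t , _)) = z ∷ (xs [ t ]%= not)
    innerStep z xs (inj₂ _)       (inj₂ _)       = not z ∷ xs

    innerParent : V → V
    innerParent (z ∷ xs) = innerStep z xs (compare RE xs) (compare (home (not z)) xs)

    type-innerStep : ∀ z xs a b → type (z ∷ xs) ≡ σ → type (innerStep z xs a b) ≡ σ
    type-innerStep z xs (inj₁ (t , t∈E , _)) _ type≡σ =
      trans (flip-outside-type z xs t λ t∈home → RE≢home z (trans (sym t∈E) t∈home)) type≡σ
    type-innerStep z xs (inj₂ _) (inj₁ (t , t∈other , _)) type≡σ =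
      trans (flip-outside-type z xs t λ t∈home → home-not≢home z (trans (sym t∈other) t∈home)) type≡σ
    type-innerStep z xs (inj₂ _) (inj₂ agree) _ = agree-type (not z) xs agree

    type-innerParent : ∀ x → type x ≡ σ → type (innerParent x) ≡ σ
    type-innerParent (z ∷ xs) = type-innerStep z xs (compare RE xs) (compare (home (not z)) xs)

    -- Once E and home (not z) agree with base,
    -- repairing j wrong positions of home z costs one switch of the leading bit for z = true, and
    -- for z = false (j > 0) a detour through leading bit true and back, i.e. j + 2 moves.
    homeCost : Bool → ℕ → ℕ
    homeCost false zero    = 0
    homeCost false (suc j) = 3 + j
    homeCost true  j       = suc j

    innerRank : V → ℕ
    innerRank (z ∷ xs) = dist RE xs + dist (home (not z)) xs + homeCost z (dist (home z) xs)

    agree-everywhere : ∀ xs → (∀ R → AgreeOn region R xs base) → xs ≡ base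
    agree-everywhere xs agree = Pointwise-≡⇒≡ (ext λ t → agree (region t) t refl)

    outside : ∀ {t R R′} → region t ≡ R → R ≢ R′ → region t ≢ R′
    outside t∈R R≢R′ t∈R′ = R≢R′ (trans (sym t∈R) t∈R′)

    detour-cost : ∀ j → j ≢ 0 → j + 1 < homeCost false j
    detour-cost zero    j≢0 = ⊥-elim (j≢0 refl)
    detour-cost (suc j) _   = s≤s (s≤s (≤-reflexive (+-comm j 1)))

    innerRank-innerStep : ∀ z xs a b → z ∷ xs ≢ root → innerRank (innerStep z xs a b) < innerRank (z ∷ xs)
    innerRank-innerStep z xs (inj₁ (t , t∈E , d)) _ _
      rewrite regionDist-flip-in region RE xs base t t∈E d
            | regionDist-flip-out region (home (not z)) xs base t (outside t∈E (RE≢home (not z)))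
            | regionDist-flip-out region (home z) xs base t (outside t∈E (RE≢home z)) = ≤-refl
    innerRank-innerStep z xs (inj₂ _) (inj₁ (t , t∈O , d)) _
      rewrite regionDist-flip-in region (home (not z)) xs base t t∈O d
            | regionDist-flip-out region RE xs base t (outside t∈O (RE≢home (not z) ∘ sym))
            | regionDist-flip-out region (home z) xs base t (outside t∈O (home-not≢home z))
            | +-suc (dist RE xs) (dist (home (not z)) (xs [ t ]%= not)) = ≤-refl
    innerRank-innerStep false xs (inj₂ agreeE) (inj₂ agreeD) x≢root
      rewrite regionDist-agree region RE xs base agreeE | regionDist-agree region RD xs base agreeD
      with compare RC xs
    ... | inj₁ (t , t∈C , d) = detour-cost (dist RC xs) λ dC≡0 →
                                 0≢1+n (trans (sym dC≡0) (regionDist-flip-in region RC xs base t t∈C d))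
    ... | inj₂ agreeC = ⊥-elim (x≢root (cong (false ∷_) (agree-everywhere xs λ
                          { RC → agreeC ; RD → agreeD ; RE → agreeE })))
    innerRank-innerStep true xs (inj₂ agreeE) (inj₂ agreeC) _
      rewrite regionDist-agree region RE xs base agreeE | regionDist-agree region RC xs base agreeC
            | +-identityʳ (dist RD xs) = ≤-refl

    innerRank-innerParent : ∀ x → x ≢ root → innerRank (innerParent x) < innerRank x
    innerRank-innerParent (z ∷ xs) = innerRank-innerStep z xs (compare RE xs) (compare (home (not z)) xs)

    innerStep-adj : ∀ z xs a b → Adj (z ∷ xs) (innerStep z xs a b)
    innerStep-adj z xs (inj₁ (t , _)) _              = suc t , refl
    innerStep-adj z xs (inj₂ _)       (inj₁ (t , _)) = suc t , refl
    innerStep-adj z xs (inj₂ _)       (inj₂ _)       = zero , refl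

    innerRank≤ : ∀ x → innerRank x ≤ L + 2
    innerRank≤ (z ∷ xs) = begin
      dE + dist (home (not z)) xs + homeCost z (dist (home z) xs)  ≤⟨ +-monoʳ-≤ (dE + _) (homeCost≤ z _) ⟩
      dE + dist (home (not z)) xs + (dist (home z) xs + 2)         ≡⟨ regroup z ⟩
      dist RC xs + dist RD xs + dE + 2                              ≤⟨ +-monoˡ-≤ 2 (regionDist-total region xs base) ⟩
      L + 2                                                         ∎
      where
      open ≤-Reasoning
      dE = dist RE xs
      homeCost≤ : ∀ z j → homeCost z j ≤ j + 2
      homeCost≤ false zero    = z≤n
      homeCost≤ false (suc j) = s≤s (≤-reflexive (+-comm 2 j))
      homeCost≤ true  j       = ≤-trans (n≤1+n (suc j)) (≤-reflexive (+-comm 2 j))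
      regroup : ∀ z → dE + dist (home (not z)) xs + (dist (home z) xs + 2) ≡ dist RC xs + dist RD xs + dE + 2
      regroup false = rearrange (dist RC xs) (dist RD xs) dE
        where rearrange : ∀ c d e → e + d + (c + 2) ≡ c + d + e + 2
              rearrange = solve-∀
      regroup true  = rearrange (dist RC xs) (dist RD xs) dE
        where rearrange : ∀ c d e → e + c + (d + 2) ≡ c + d + e + 2
              rearrange = solve-∀

    leafParent : V → V
    leafParent (z ∷ xs) = z ∷ (xs [ slot z (firstBit σ s) (s ⊕ σ) ]%= not)
      where s = type (z ∷ xs)

    type-leafParent : ∀ x → type (leafParent x) ≡ σ
    type-leafParent (z ∷ xs) =
      trans (syndrome-flip (weight z) xs _) (trans (cong (s ⊕_) (weight-slot z _ _)) (⊕-cancelˡ s σ))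
      where s = type (z ∷ xs)

    parent : V → V
    parent x with type x ≟V σ
    ... | yes _ = innerParent x
    ... | no _  = leafParent x

    rank : V → ℕ
    rank x with type x ≟V σ
    ... | yes _ = innerRank x
    ... | no _  = suc (innerRank (leafParent x))

    type-parent : ∀ x → type (parent x) ≡ σ
    type-parent x with type x ≟V σ
    ... | yes type≡σ = type-innerParent x type≡σ
    ... | no _       = type-leafParent x

    rank-inner : ∀ x → type x ≡ σ → rank x ≡ innerRank x
    rank-inner x type≡σ with type x ≟V σ
    ... | yes _      = refl
    ... | no type≢σ  = ⊥-elim (type≢σ type≡σ)

    parent-leaf : ∀ x → type x ≢ σ → parent x ≡ leafParent x
    parent-leaf x type≢σ with type x ≟V σ
    ... | yes type≡σ = ⊥-elim (type≢σ type≡σ)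
    ... | no _       = refl

    parent-adj : ∀ x → Adj x (parent x)
    parent-adj (z ∷ xs) with type (z ∷ xs) ≟V σ
    ... | yes _ = innerStep-adj z xs (compare RE xs) (compare (home (not z)) xs)
    ... | no _  = suc _ , refl

    rank-parent : ∀ x → x ≢ root → rank (parent x) < rank x
    rank-parent x x≢root with type x ≟V σ
    ... | yes type≡σ rewrite rank-inner (innerParent x) (type-innerParent x type≡σ) = innerRank-innerParent x x≢root
    ... | no _ rewrite rank-inner (leafParent x) (type-leafParent x) = ≤-refl

    rank≤ : ∀ x → rank x ≤ L + 3
    rank≤ x with type x ≟V σ
    ... | yes _ = ≤-trans (innerRank≤ x) (+-monoʳ-≤ L (n≤1+n 2))
    ... | no _  = ≤-trans (s≤s (innerRank≤ (leafParent x))) (≤-reflexive (sym (+-suc L 2)))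

    rankedParent : RankedParent (suc L) (L + 3)
    rankedParent = record
      { parent      = parent
      ; root        = root
      ; rank        = rank
      ; parent-adj  = λ x _ → parent-adj x
      ; rank-parent = rank-parent
      ; rank≤       = rank≤ }

  open TreeOfType using (rankedParent; type-parent; parent-leaf; leafParent)
  open RankedParentTree using (Child; Internal)

  internal-type : ∀ σ {x} → Internal (rankedParent σ) x → type x ≡ σ
  internal-type σ (c , _ , refl) = type-parent σ c

  -- A cross edge would make both ends leaves, each attached to the other by flipping a slot;
  -- firstBit makes these two slots differ, so flipping both cannot return to the start.
  no-crossing : ∀ σ τ → σ ≢ τ → ∀ {u v} → Child (rankedParent σ) u v → ¬ Child (rankedParent τ) v u
  no-crossing σ τ σ≢τ {z ∷ xs} {v} (_ , u↦v) (_ , v↦u) = not-¬ refl (sym flipped-twice)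
    where
    type-u : type (z ∷ xs) ≡ τ
    type-u = subst (λ y → type y ≡ τ) v↦u (type-parent τ v)
    type-v : type v ≡ σ
    type-v = subst (λ y → type y ≡ σ) u↦v (type-parent σ (z ∷ xs))
    leaf-u : leafParent σ (z ∷ xs) ≡ v
    leaf-u = trans (sym (parent-leaf σ (z ∷ xs) λ type≡σ → σ≢τ (trans (sym type≡σ) type-u))) u↦v
    leaf-v : leafParent τ v ≡ z ∷ xs
    leaf-v = trans (sym (parent-leaf τ v λ type≡τ → σ≢τ (trans (sym type-v) type≡τ))) v↦u
    t₁ = slot z (firstBit σ (type (z ∷ xs))) (type (z ∷ xs) ⊕ σ)
    ys = xs [ t₁ ]%= not
    t₂ = slot z (firstBit τ (type (z ∷ ys))) (type (z ∷ ys) ⊕ τ)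
    type-ys : type (z ∷ ys) ≡ σ
    type-ys = subst (λ y → type y ≡ σ) (sym leaf-u) type-v
    t₁≢t₂ : t₁ ≢ t₂
    t₁≢t₂ t₁≡t₂ = firstBit-asym σ τ σ≢τ (begin
      firstBit σ τ                   ≡⟨ cong (firstBit σ) type-u ⟨
      firstBit σ (type (z ∷ xs))     ≡⟨ slot-bit-injective z t₁≡t₂ ⟩
      firstBit τ (type (z ∷ ys))     ≡⟨ cong (firstBit τ) type-ys ⟩
      firstBit τ σ                   ∎)
      where open ≡-Reasoning
    flipped-twice : not (lookup xs t₁) ≡ lookup xs t₁
    flipped-twice = begin
      not (lookup xs t₁)                 ≡⟨ lookup∘updateAt t₁ xs ⟨
      lookup ys t₁                       ≡⟨ lookup∘updateAt′ t₁ t₂ t₁≢t₂ ys ⟨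
      lookup (ys [ t₂ ]%= not) t₁        ≡⟨ cong (λ w → lookup (tail w) t₁) (trans (cong (leafParent τ) leaf-u) leaf-v) ⟩
      lookup xs t₁                       ∎
      where open ≡-Reasoning

  module _ (m : ℕ) (m≤ : m ≤ pow2 k) where

    types : Fin m → Vec Bool k
    types i = toBits k (inject≤ i m≤)

    types-injective : ∀ {i j} → types i ≡ types j → i ≡ j
    types-injective eq = inject≤-injective m≤ m≤ _ _ (toBits-injective k eq)

    open CompletelyIndependentFamily (rankedParent ∘ types)
      (λ i j x∈i x∈j → types-injective (trans (sym (internal-type (types i) x∈i)) (internal-type (types j) x∈j)))
      (λ i j i≢j → no-crossing (types i) (types j) (i≢j ∘ types-injective))

    family : CIFamily (suc L) m ((L + 3) + (L + 3))
    family = trees , trees-pairwiseCI , λ i → RankedParentTree.spanningTree-diameter (rankedParent (types i))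

-- Dimension count and asymptotics

DiameterAtMost-mono : ∀ {n} (T : SpanningTree n) {d d′} → d ≤ d′ → DiameterAtMost T d → DiameterAtMost T d′
DiameterAtMost-mono T d≤d′ diam u v = let vs , w , |vs|≤ = diam u v in vs , w , ≤-trans |vs|≤ (s≤s d≤d′)

CIFamily-mono : ∀ {n m d d′} → d ≤ d′ → CIFamily n m d → CIFamily n m d′
CIFamily-mono d≤d′ (ts , ci , diam) = ts , ci , λ i → DiameterAtMost-mono (ts i) d≤d′ (diam i)

pow2≥1 : ∀ k → 1 ≤ pow2 k
pow2≥1 zero    = ≤-refl
pow2≥1 (suc k) = ≤-trans (pow2≥1 k) (m≤m+n _ _)

pow2-between : ∀ m → ∃[ k ] (m ≤ pow2 k × pow2 k ≤ 2 * m + 1)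
pow2-between zero = 0 , z≤n , ≤-refl
pow2-between (suc m) with pow2-between m
... | k , m≤P , P≤ with suc m ≤? pow2 k
...   | yes m<P = k , m<P , ≤-trans P≤ (+-monoˡ-≤ 1 (*-monoʳ-≤ 2 (n≤1+n m)))
...   | no  m≮P = suc k , m<P+P , P+P≤
  where
  open ≤-Reasoning
  P≡m : pow2 k ≡ m
  P≡m = ≤-antisym (≤-pred (≰⇒> m≮P)) m≤P
  m<P+P : suc m ≤ pow2 k + pow2 k
  m<P+P = begin
    1 + m              ≤⟨ +-monoˡ-≤ m (pow2≥1 k) ⟩
    pow2 k + m         ≡⟨ cong (pow2 k +_) P≡m ⟨
    pow2 k + pow2 k    ∎
  P+P≤ : pow2 k + pow2 k ≤ 2 * suc m + 1
  P+P≤ = begin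
    pow2 k + pow2 k    ≡⟨ cong₂ _+_ P≡m P≡m ⟩
    m + m              ≤⟨ m≤m+n (m + m) 3 ⟩
    m + m + 3          ≡⟨ double-suc m ⟩
    2 * suc m + 1      ∎
    where
    double-suc : ∀ m → m + m + 3 ≡ 2 * suc m + 1
    double-suc = solve-∀

split-dimension : ∀ n k → 15 ≤ n → pow2 k ≤ 2 * (n / 12) + 1 →
                  ∃[ e ] (suc (pow2 (suc k) + (pow2 (suc k) + e)) ≡ n)
split-dimension n k 15≤n P≤ = n ∸ suc 4P , trans (cong suc (sym (+-assoc A A _))) (m+[n∸m]≡n 4P<n)
  where
  m = n / 12
  P = pow2 k
  A = P + P
  4P = A + A
  open ≤-Reasoning
  4P<n : suc 4P ≤ n
  4P<n = *-cancelˡ-≤ 3 (begin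
    3 * suc 4P            ≡⟨ eq₁ P ⟩
    12 * P + 3            ≤⟨ +-monoˡ-≤ 3 (*-monoʳ-≤ 12 P≤) ⟩
    12 * (2 * m + 1) + 3  ≡⟨ eq₂ m ⟩
    2 * (m * 12) + 15     ≤⟨ +-mono-≤ (*-monoʳ-≤ 2 (m/n*n≤m n 12)) 15≤n ⟩
    2 * n + n             ≡⟨ eq₃ n ⟩
    3 * n                 ∎)
    where
    eq₁ : ∀ P → 3 * suc ((P + P) + (P + P)) ≡ 12 * P + 3
    eq₁ = solve-∀
    eq₂ : ∀ m → 12 * (2 * m + 1) + 3 ≡ 2 * (m * 12) + 15
    eq₂ = solve-∀
    eq₃ : ∀ n → 2 * n + n ≡ 3 * n
    eq₃ = solve-∀

CIFamily-n/12 : ∀ n → 15 ≤ n → CIFamily n (n / 12) (2 * n + 4)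
CIFamily-n/12 n 15≤n with pow2-between (n / 12)
... | k , m≤P , P≤ = subst (λ n′ → CIFamily n′ (n / 12) (2 * n′ + 4)) 1+L≡n
                       (CIFamily-mono (≤-reflexive (diameter-arith L)) (Construction.family k e (n / 12) m≤P))
  where
  e = proj₁ (split-dimension n k 15≤n P≤)
  L = Construction.L k e
  1+L≡n : suc L ≡ n
  1+L≡n = proj₂ (split-dimension n k 15≤n P≤)
  diameter-arith : ∀ L → (L + 3) + (L + 3) ≡ 2 * suc L + 4
  diameter-arith = solve-∀

n/12-ratio : RatioTendsTo (_/ 12) 1 12
n/12-ratio k = suc k , λ n k<n → begin-strict
  suc k * ∣ 12 * (n / 12) - 1 * n ∣  ≡⟨ cong (suc k *_) (error-is-remainder n) ⟩
  suc k * (n % 12)                   <⟨ *-monoʳ-< (suc k) (m%n<n n 12) ⟩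
  suc k * 12                         ≡⟨ *-comm (suc k) 12 ⟩
  12 * suc k                         ≤⟨ *-monoʳ-≤ 12 k<n ⟩
  12 * n                             ∎
  where
  open ≤-Reasoning
  error-is-remainder : ∀ n → ∣ 12 * (n / 12) - 1 * n ∣ ≡ n % 12
  error-is-remainder n = begin-equality
    ∣ 12 * (n / 12) - 1 * n ∣                    ≡⟨ cong (λ x → ∣ 12 * (n / 12) - x ∣) (*-identityˡ n) ⟩
    ∣ 12 * (n / 12) - n ∣                        ≡⟨ cong (λ x → ∣ 12 * (n / 12) - x ∣) (division n) ⟩
    ∣ 12 * (n / 12) - 12 * (n / 12) + n % 12 ∣   ≡⟨ ∣m-m+n∣≡n (12 * (n / 12)) (n % 12) ⟩
    n % 12                                       ∎
    where
    division : ∀ n → n ≡ 12 * (n / 12) + n % 12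
    division n = trans (m≡m%n+[m/n]*n n 12) (trans (+-comm (n % 12) _) (cong (_+ n % 12) (*-comm (n / 12) 12)))

2n+4-ratio : RatioTendsTo (λ n → 2 * n + 4) 2 1
2n+4-ratio k = suc (suc k * 4) , λ n 4k<n → begin-strict
  suc k * ∣ 1 * (2 * n + 4) - 2 * n ∣  ≡⟨ cong (suc k *_) (error-is-4 n) ⟩
  suc k * 4                           <⟨ 4k<n ⟩
  n                                   ≡⟨ *-identityˡ n ⟨
  1 * n                               ∎
  where
  open ≤-Reasoning
  error-is-4 : ∀ n → ∣ 1 * (2 * n + 4) - 2 * n ∣ ≡ 4
  error-is-4 n = trans (cong (λ x → ∣ x - 2 * n ∣) (*-identityˡ (2 * n + 4)))
                   (trans (∣-∣-comm (2 * n + 4) (2 * n)) (∣m-m+n∣≡n (2 * n) 4))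

theorem2 : ∃[ f ] ∃[ g ] (RatioTendsTo f 1 12 × RatioTendsTo g 2 1 ×
             ∃[ N ] ∀ (n : ℕ) → n ≥ N →
               ∃[ ts ] (PairwiseCI {n} {f n} ts ×
                        (∀ (i : Fin (f n)) → DiameterAtMost (ts i) (g n))))
theorem2 = (_/ 12) , (λ n → 2 * n + 4) , n/12-ratio , 2n+4-ratio , 15 , CIFamily-n/12
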